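{- Let $G$ be a graph and $T\subseteq V(G)$ with $|E(G)|+|T|$ even. Let $\langle V_0,\dots,V_k\rangle$ be a $T$-decomposition of $G$ and let $i\in\{0,\dots,k\}$. If $|E(G[V_j])|+|T_j|$ is even for every $j\in\{0,\dots,k\}\setminus\{i\}$, then $|E(G[V_j])|+|T_j|$ is even for every $j\in\{0,\dots,k\}$ (i.e. the decomposition satisfies $\mathcal{P}$).
   Context: Graphs are finite and simple. A $T$-decomposition of $G$ is an ordered sequence $\langle V_0,\dots,V_k\rangle$ of pairwise disjoint subsets of $V(G)$ whose union is $V(G)$. For each $j$, $Z_j$ is the set of vertices of $V_j$ having an odd number of neighbors in $V_0\cup\dots\cup V_{j-1}$, and $T_j=Z_j\,\triangle\,(T\cap V_j)$ ($\triangle$ = symmetric difference). $T_j$ satisfies $\mathcal{P}$ in $G[V_j]$ means $|E(G[V_j])|+|T_j|$ is even. -}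

module Defs where

open import Data.Nat using (ℕ; zero; suc; _+_; _<ᵇ_)
open import Data.Nat.Properties using ()
open import Data.Bool using (Bool; true; false; _∧_; _xor_; if_then_else_; T)
open import Data.Fin using (Fin; toℕ; _<_)
open import Data.Fin.Properties using ()
open import Data.List using (List; filter; length; allFin; cartesianProduct)
open import Data.Product using (_×_; _,_; proj₁; proj₂)
open import Relation.Binary.PropositionalEquality using (_≡_)
open import Relation.Nullary using (¬_)
open import Relation.Nullary.Decidable using (yes; no)

record Graph (n : ℕ) : Set where
  field
    adj     : Fin n → Fin n → Bool
    symm    : ∀ u v → adj u v ≡ adj v u
    irrefl  : ∀ v → adj v v ≡ false

open Graph public

VSet : ℕ → Set
VSet n = Fin n → Bool

card : ∀ {n} → VSet n → ℕ
card {n} S = length (filter (λ v → T? (S v)) (allFin n))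
  where
  T? : (b : Bool) → Relation.Nullary.Dec (T b)
  T? true  = yes _
  T? false = no (λ ())

even : ℕ → Bool
even zero = true
even (suc m) = Data.Bool.not (even m)

Even : ℕ → Set
Even m = even m ≡ true

-- |E(G[S])| : number of unordered pairs {u,v} (counted once, via toℕ u < toℕ v)
-- of adjacent vertices both in S
edgesIn : ∀ {n} → Graph n → VSet n → ℕ
edgesIn {n} G S =
  length (filter (λ p → T? (S (proj₁ p) ∧ S (proj₂ p) ∧ (toℕ (proj₁ p) <ᵇ toℕ (proj₂ p)) ∧ adj G (proj₁ p) (proj₂ p)))
                 (cartesianProduct (allFin n) (allFin n)))
  where
  T? : (b : Bool) → Relation.Nullary.Dec (T b)
  T? true  = yes _
  T? false = no (λ ())

-- A T-decomposition ⟨V_0,…,V_k⟩ of V(G) is encoded by the map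
-- part : Fin n → Fin (suc k) sending each vertex to the index of the unique
-- part containing it (pairwise disjoint, union = V(G)).
Decomp : ℕ → ℕ → Set
Decomp n k = Fin n → Fin (suc k)

partSet : ∀ {n k} → Decomp n k → Fin (suc k) → VSet n
partSet part j v = ⌊ part v Data.Fin.≟ j ⌋
  where open Relation.Nullary.Decidable using (⌊_⌋)

before : ∀ {n k} → Decomp n k → Fin (suc k) → VSet n
before part j v = toℕ (part v) <ᵇ toℕ j

degIn : ∀ {n} → Graph n → VSet n → Fin n → ℕ
degIn G S v = card (λ u → S u ∧ adj G v u)

Zset : ∀ {n k} → Graph n → Decomp n k → Fin (suc k) → VSet n
Zset G part j v = partSet part j v ∧ Data.Bool.not (even (degIn G (before part j) v))

Tset : ∀ {n k} → Graph n → VSet n → Decomp n k → Fin (suc k) → VSet n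
Tset G Tv part j v = Zset G part j v xor (Tv v ∧ partSet part j v)

SatP : ∀ {n k} → Graph n → VSet n → Decomp n k → Fin (suc k) → Set
SatP G Tv part j = Even (edgesIn G (partSet part j) + card (Tset G Tv part j))

edgeCount : ∀ {n} → Graph n → ℕ
edgeCount G = edgesIn G (λ _ → true)

{-# OPTIONS --safe #-}
-- Work modulo 2, where |X| is the xor-sum of the indicator of X.  Summing
-- |E(G[V_j])| + |T_j| over all j, the edges inside the parts contribute the
-- edges of G with both ends in one part, the sets Z_j contribute (through the
-- odd degrees into earlier parts) every edge between two different parts
-- exactly once, and the sets T ∩ V_j contribute T.  Hence
--   Σ_j (|E(G[V_j])| + |T_j|) ≡ |E(G)| + |T|  (mod 2),
-- so if all but one summand is even and the right-hand side is even, then so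
-- is the remaining summand.
module Submission where

open import Defs

open import Algebra.Bundles using (CommutativeMonoid; CommutativeRing)
import Algebra.Properties.CommutativeMonoid.Sum as Sum
open import Data.Bool using (Bool; true; false; not; _∧_; _xor_; T)
open import Data.Bool.Properties
  using (not-distribˡ-xor; not-injective; xor-assoc; xor-identityʳ; ∧-comm; ∧-zeroʳ;
         ∧-distribˡ-xor; ∧-distribʳ-xor; xor-∧-commutativeRing)
open import Data.Fin using (Fin; zero; suc; toℕ; _≟_; punchIn)
open import Data.Fin.Properties using (punchInᵢ≢i)
open import Data.List using ([]; _∷_; _++_; map; length; filter; tabulate; cartesianProduct)
open import Data.List.Properties using (map-tabulate)
open import Data.Nat using (ℕ; zero; suc; _+_; _<ᵇ_)
open import Data.Product using (_×_; _,_)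
open import Data.Vec.Functional using (Vector; replicate; removeAt)
open import Function using (_∘_; id)
open import Relation.Binary.PropositionalEquality
  using (_≡_; _≢_; refl; sym; trans; cong; cong₂; module ≡-Reasoning)
import Relation.Binary.Reasoning.Setoid as SetoidReasoning
open import Relation.Nullary using (yes; no; contradiction)
open import Relation.Nullary.Decidable using (⌊_⌋; ⌊⌋-map′; isYes≗does; dec-true; dec-false)
open import Relation.Unary using (Decidable)

odd : ℕ → Bool
odd m = not (even m)

odd-+ : ∀ m n → odd (m + n) ≡ odd m xor odd n
odd-+ zero    n = refl
odd-+ (suc m) n = trans (cong not (odd-+ m n)) (not-distribˡ-xor (odd m) (odd n))

Even⇒odd≡false : ∀ {m} → Even m → odd m ≡ false
Even⇒odd≡false = cong not

odd≡false⇒Even : ∀ {m} → odd m ≡ false → Even m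
odd≡false⇒Even = not-injective

module _ {c ℓ} (M : CommutativeMonoid c ℓ) where
  open CommutativeMonoid M
  open Sum M using (sum; sum-remove; sum-cong-≋; sum-replicate-zero)
  open SetoidReasoning setoid

  sum-single-support : ∀ {m} (t : Vector Carrier m) i → (∀ j → j ≢ i → t j ≈ ε) → sum t ≈ t i
  sum-single-support {suc m} t i t≈ε = begin
    sum t                          ≈⟨ sum-remove {i = i} t ⟩
    t i ∙ sum (removeAt t i)       ≈⟨ ∙-congˡ (sum-cong-≋ (λ j → t≈ε (punchIn i j) (punchInᵢ≢i i j))) ⟩
    t i ∙ sum (replicate m ε)      ≈⟨ ∙-congˡ (sum-replicate-zero m) ⟩
    t i ∙ ε                        ≈⟨ identityʳ (t i) ⟩
    t i                            ∎

xor-commutativeMonoid : CommutativeMonoid _ _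
xor-commutativeMonoid = CommutativeRing.+-commutativeMonoid xor-∧-commutativeRing

open Sum xor-commutativeMonoid using (sum; sum-syntax; sum-cong-≗; ∑-comm; ∑-distrib-+)

-- ⌊_⌋ is isYes, which the library's lemmas about does reach only through isYes≗does.
∑-indicator : ∀ {m} (i : Fin m) (f : Fin m → Bool) → ∑[ j < m ] (⌊ i ≟ j ⌋ ∧ f j) ≡ f i
∑-indicator i f = trans
  (sum-single-support xor-commutativeMonoid _ i
    (λ j j≢i → cong (_∧ f j) (trans (isYes≗does (i ≟ j)) (dec-false (i ≟ j) (j≢i ∘ sym)))))
  (cong (_∧ f i) (trans (isYes≗does (i ≟ i)) (dec-true (i ≟ i) refl)))

<ᵇ-trichotomy : ∀ {m} (x y : Fin m) → (toℕ x <ᵇ toℕ y) xor (toℕ y <ᵇ toℕ x) ≡ not ⌊ x ≟ y ⌋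
<ᵇ-trichotomy zero    zero    = refl
<ᵇ-trichotomy zero    (suc y) = refl
<ᵇ-trichotomy (suc x) zero    = refl
<ᵇ-trichotomy (suc x) (suc y) = trans (<ᵇ-trichotomy x y) (cong not (sym (⌊⌋-map′ _ _ (x ≟ y))))

module _ {n : ℕ} where
  ∑² : (Fin n → Fin n → Bool) → Bool
  ∑² f = ∑[ u < n ] ∑[ v < n ] f u v

  ∑²-cong : {f g : Fin n → Fin n → Bool} → (∀ u v → f u v ≡ g u v) → ∑² f ≡ ∑² g
  ∑²-cong f≡g = sum-cong-≗ (λ u → sum-cong-≗ (f≡g u))

  ∑²-distrib-xor : (f g : Fin n → Fin n → Bool) → ∑² (λ u v → f u v xor g u v) ≡ ∑² f xor ∑² g
  ∑²-distrib-xor f g = trans (sum-cong-≗ (λ u → ∑-distrib-+ (f u) (g u))) (∑-distrib-+ (sum ∘ f) (sum ∘ g))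

  ∑²-by-order : (f : Fin n → Fin n → Bool) → (∀ v → f v v ≡ false) →
                ∑² f ≡ ∑² (λ u v → (toℕ u <ᵇ toℕ v) ∧ (f u v xor f v u))
  ∑²-by-order f f-diag = begin
    ∑² f                                                        ≡⟨ ∑²-cong split ⟩
    ∑² (λ u v → (u < v) ∧ f u v xor (v < u) ∧ f u v)            ≡⟨ ∑²-distrib-xor _ _ ⟩
    ∑² (λ u v → (u < v) ∧ f u v) xor ∑² (λ u v → (v < u) ∧ f u v)
      ≡⟨ cong (∑² (λ u v → (u < v) ∧ f u v) xor_) (∑-comm (λ u v → (v < u) ∧ f u v)) ⟩
    ∑² (λ u v → (u < v) ∧ f u v) xor ∑² (λ u v → (u < v) ∧ f v u) ≡⟨ ∑²-distrib-xor _ _ ⟨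
    ∑² (λ u v → (u < v) ∧ f u v xor (u < v) ∧ f v u)
      ≡⟨ ∑²-cong (λ u v → ∧-distribˡ-xor (u < v) (f u v) (f v u)) ⟨
    ∑² (λ u v → (u < v) ∧ (f u v xor f v u))                    ∎
    where
    open ≡-Reasoning
    _<_ : Fin n → Fin n → Bool
    u < v = toℕ u <ᵇ toℕ v

    off-diagonal : ∀ u v → f u v ≡ not ⌊ u ≟ v ⌋ ∧ f u v
    off-diagonal u v with u ≟ v
    ... | yes refl = f-diag u
    ... | no _     = refl

    split : ∀ u v → f u v ≡ (u < v) ∧ f u v xor (v < u) ∧ f u v
    split u v = begin
      f u v                               ≡⟨ off-diagonal u v ⟩
      not ⌊ u ≟ v ⌋ ∧ f u v               ≡⟨ cong (_∧ f u v) (<ᵇ-trichotomy u v) ⟨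
      ((u < v) xor (v < u)) ∧ f u v       ≡⟨ ∧-distribʳ-xor (f u v) (u < v) (v < u) ⟩
      (u < v) ∧ f u v xor (v < u) ∧ f u v ∎

module _ {a} {A : Set a} (p : A → Bool) (p? : Decidable (T ∘ p)) where
  odd-count-∷ : ∀ x xs → odd (length (filter p? (x ∷ xs))) ≡ p x xor odd (length (filter p? xs))
  odd-count-∷ x xs with p x | p? x
  ... | true  | yes _   = refl
  ... | true  | no ¬px  = contradiction _ ¬px
  ... | false | no _    = refl

  odd-count-++ : ∀ xs ys → odd (length (filter p? (xs ++ ys)))
                           ≡ odd (length (filter p? xs)) xor odd (length (filter p? ys))
  odd-count-++ []       ys = refl
  odd-count-++ (x ∷ xs) ys = begin
    odd (length (filter p? (x ∷ xs ++ ys)))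
      ≡⟨ odd-count-∷ x (xs ++ ys) ⟩
    p x xor odd (length (filter p? (xs ++ ys)))
      ≡⟨ cong (p x xor_) (odd-count-++ xs ys) ⟩
    p x xor (odd (length (filter p? xs)) xor odd (length (filter p? ys)))
      ≡⟨ xor-assoc (p x) _ _ ⟨
    (p x xor odd (length (filter p? xs))) xor odd (length (filter p? ys))
      ≡⟨ cong (_xor odd (length (filter p? ys))) (odd-count-∷ x xs) ⟨
    odd (length (filter p? (x ∷ xs))) xor odd (length (filter p? ys)) ∎
    where open ≡-Reasoning

  odd-count-tabulate : ∀ {m} (f : Fin m → A) → odd (length (filter p? (tabulate f))) ≡ ∑[ i < m ] p (f i)
  odd-count-tabulate {zero}  f = refl
  odd-count-tabulate {suc m} f =
    trans (odd-count-∷ (f zero) _) (cong (p (f zero) xor_) (odd-count-tabulate (f ∘ suc)))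

odd-count-cartesianProduct :
  ∀ {b c} {B : Set b} {C : Set c} (p : B × C → Bool) (p? : Decidable (T ∘ p))
    {m n} (f : Fin m → B) (g : Fin n → C) →
  odd (length (filter p? (cartesianProduct (tabulate f) (tabulate g))))
  ≡ ∑[ i < m ] ∑[ j < n ] p (f i , g j)
odd-count-cartesianProduct p p? {zero}  f g = refl
odd-count-cartesianProduct p p? {suc m} f g = begin
  odd (length (filter p? (map (f zero ,_) (tabulate g) ++ cartesianProduct (tabulate (f ∘ suc)) (tabulate g))))
    ≡⟨ odd-count-++ p p? (map (f zero ,_) (tabulate g)) _ ⟩
  odd (length (filter p? (map (f zero ,_) (tabulate g))))
    xor odd (length (filter p? (cartesianProduct (tabulate (f ∘ suc)) (tabulate g))))
    ≡⟨ cong₂ _xor_ first-row (odd-count-cartesianProduct p p? (f ∘ suc) g) ⟩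
  ∑[ j < _ ] p (f zero , g j) xor ∑[ i < m ] ∑[ j < _ ] p (f (suc i) , g j) ∎
  where
  open ≡-Reasoning
  first-row : odd (length (filter p? (map (f zero ,_) (tabulate g)))) ≡ ∑[ j < _ ] p (f zero , g j)
  first-row = trans (cong (odd ∘ length ∘ filter p?) (map-tabulate g (f zero ,_)))
                    (odd-count-tabulate p p? ((f zero ,_) ∘ g))

odd-card : ∀ {n} (S : VSet n) → odd (card S) ≡ ∑[ v < n ] S v
odd-card S = odd-count-tabulate S _ id

odd-edgesIn : ∀ {n} (G : Graph n) (S : VSet n) →
              odd (edgesIn G S) ≡ ∑² (λ u v → S u ∧ S v ∧ (toℕ u <ᵇ toℕ v) ∧ adj G u v)
odd-edgesIn G S =
  odd-count-cartesianProduct (λ (u , v) → S u ∧ S v ∧ (toℕ u <ᵇ toℕ v) ∧ adj G u v) _ id id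

module _ {n k} (G : Graph n) (Tv : VSet n) (part : Decomp n k) where
  orderedEdge : Fin n → Fin n → Bool
  orderedEdge u v = (toℕ u <ᵇ toℕ v) ∧ adj G u v

  samePartEdge : Fin n → Fin n → Bool
  samePartEdge u v = ⌊ part v ≟ part u ⌋ ∧ orderedEdge u v

  earlierPartEdge : Fin n → Fin n → Bool
  earlierPartEdge v u = before part (part v) u ∧ adj G v u

  ∑-odd-edgesIn-parts : ∑[ j < suc k ] odd (edgesIn G (partSet part j))
                        ≡ ∑² samePartEdge
  ∑-odd-edgesIn-parts = begin
    ∑[ j < suc k ] odd (edgesIn G (partSet part j))
      ≡⟨ sum-cong-≗ (odd-edgesIn G ∘ partSet part) ⟩
    ∑[ j < suc k ] ∑² (λ u v → partSet part j u ∧ partSet part j v ∧ orderedEdge u v)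
      ≡⟨ ∑-comm (λ j u → ∑[ v < n ] (partSet part j u ∧ partSet part j v ∧ orderedEdge u v)) ⟩
    ∑[ u < n ] ∑[ j < suc k ] ∑[ v < n ] (partSet part j u ∧ partSet part j v ∧ orderedEdge u v)
      ≡⟨ sum-cong-≗ (λ u → ∑-comm (λ j v → partSet part j u ∧ partSet part j v ∧ orderedEdge u v)) ⟩
    ∑² (λ u v → ∑[ j < suc k ] (⌊ part u ≟ j ⌋ ∧ ⌊ part v ≟ j ⌋ ∧ orderedEdge u v))
      ≡⟨ ∑²-cong (λ u v → ∑-indicator (part u) (λ j → ⌊ part v ≟ j ⌋ ∧ orderedEdge u v)) ⟩
    ∑² samePartEdge ∎
    where open ≡-Reasoning

  ∑-Zset : ∀ v → ∑[ j < suc k ] Zset G part j v ≡ ∑[ u < n ] earlierPartEdge v u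
  ∑-Zset v = trans (∑-indicator (part v) (λ j → odd (degIn G (before part j) v)))
                   (odd-card (earlierPartEdge v))

  ∑-T∩partSet : ∀ v → ∑[ j < suc k ] (Tv v ∧ partSet part j v) ≡ Tv v
  ∑-T∩partSet v = trans (sum-cong-≗ (λ j → ∧-comm (Tv v) (partSet part j v)))
                        (∑-indicator (part v) (λ _ → Tv v))

  ∑-odd-card-Tset : ∑[ j < suc k ] odd (card (Tset G Tv part j))
                    ≡ ∑² earlierPartEdge xor ∑[ v < n ] Tv v
  ∑-odd-card-Tset = begin
    ∑[ j < suc k ] odd (card (Tset G Tv part j))
      ≡⟨ sum-cong-≗ (odd-card ∘ Tset G Tv part) ⟩
    ∑[ j < suc k ] ∑[ v < n ] Tset G Tv part j v
      ≡⟨ ∑-comm (λ j v → Tset G Tv part j v) ⟩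
    ∑[ v < n ] ∑[ j < suc k ] (Zset G part j v xor (Tv v ∧ partSet part j v))
      ≡⟨ sum-cong-≗ (λ v → ∑-distrib-+ (λ j → Zset G part j v) (λ j → Tv v ∧ partSet part j v)) ⟩
    ∑[ v < n ] (∑[ j < suc k ] Zset G part j v xor ∑[ j < suc k ] (Tv v ∧ partSet part j v))
      ≡⟨ sum-cong-≗ (λ v → cong₂ _xor_ (∑-Zset v) (∑-T∩partSet v)) ⟩
    ∑[ v < n ] (∑[ u < n ] earlierPartEdge v u xor Tv v)
      ≡⟨ ∑-distrib-+ (λ v → ∑[ u < n ] earlierPartEdge v u) Tv ⟩
    ∑² earlierPartEdge xor ∑[ v < n ] Tv v ∎
    where open ≡-Reasoning

  ∑-samePartEdge-xor-earlierPartEdge : ∑² samePartEdge xor ∑² earlierPartEdge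
                               ≡ ∑² orderedEdge
  ∑-samePartEdge-xor-earlierPartEdge = begin
    ∑² samePartEdge xor ∑² earlierPartEdge
      ≡⟨ cong (∑² samePartEdge xor_) (∑²-by-order earlierPartEdge earlierPartEdge-irrefl) ⟩
    ∑² samePartEdge xor ∑² (λ u v → (toℕ u <ᵇ toℕ v) ∧ (earlierPartEdge u v xor earlierPartEdge v u))
      ≡⟨ ∑²-distrib-xor samePartEdge _ ⟨
    ∑² (λ u v → samePartEdge u v xor ((toℕ u <ᵇ toℕ v) ∧ (earlierPartEdge u v xor earlierPartEdge v u)))
      ≡⟨ ∑²-cong edge-counted-once ⟩
    ∑² orderedEdge ∎
    where
    open ≡-Reasoning
    earlierPartEdge-irrefl : ∀ v → earlierPartEdge v v ≡ false
    earlierPartEdge-irrefl v = trans (cong (before part (part v) v ∧_) (irrefl G v)) (∧-zeroʳ _)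

    excluded-middle-xor : ∀ e l a → (e ∧ (l ∧ a)) xor (l ∧ (not e ∧ a)) ≡ l ∧ a
    excluded-middle-xor true  true  a = xor-identityʳ a
    excluded-middle-xor true  false a = refl
    excluded-middle-xor false l     a = refl

    edge-counted-once : ∀ u v →
      samePartEdge u v xor ((toℕ u <ᵇ toℕ v) ∧ (earlierPartEdge u v xor earlierPartEdge v u))
      ≡ orderedEdge u v
    edge-counted-once u v = begin
      (e ∧ (l ∧ a)) xor (l ∧ ((x ∧ a) xor (y ∧ adj G v u)))
        ≡⟨ cong (λ b → (e ∧ (l ∧ a)) xor (l ∧ ((x ∧ a) xor (y ∧ b)))) (symm G v u) ⟩
      (e ∧ (l ∧ a)) xor (l ∧ ((x ∧ a) xor (y ∧ a)))
        ≡⟨ cong (λ b → (e ∧ (l ∧ a)) xor (l ∧ b)) (∧-distribʳ-xor a x y) ⟨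
      (e ∧ (l ∧ a)) xor (l ∧ ((x xor y) ∧ a))
        ≡⟨ cong (λ b → (e ∧ (l ∧ a)) xor (l ∧ (b ∧ a))) (<ᵇ-trichotomy (part v) (part u)) ⟩
      (e ∧ (l ∧ a)) xor (l ∧ (not e ∧ a))
        ≡⟨ excluded-middle-xor e l a ⟩
      l ∧ a ∎
      where
      e = ⌊ part v ≟ part u ⌋
      l = toℕ u <ᵇ toℕ v
      a = adj G u v
      x = toℕ (part v) <ᵇ toℕ (part u)
      y = toℕ (part u) <ᵇ toℕ (part v)

  ∑-odd-SatP : ∑[ j < suc k ] odd (edgesIn G (partSet part j) + card (Tset G Tv part j))
               ≡ odd (edgeCount G + card Tv)
  ∑-odd-SatP = begin
    ∑[ j < suc k ] odd (edgesIn G (partSet part j) + card (Tset G Tv part j))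
      ≡⟨ sum-cong-≗ (λ j → odd-+ (edgesIn G (partSet part j)) (card (Tset G Tv part j))) ⟩
    ∑[ j < suc k ] (odd (edgesIn G (partSet part j)) xor odd (card (Tset G Tv part j)))
      ≡⟨ ∑-distrib-+ (λ j → odd (edgesIn G (partSet part j))) (λ j → odd (card (Tset G Tv part j))) ⟩
    ∑[ j < suc k ] odd (edgesIn G (partSet part j)) xor ∑[ j < suc k ] odd (card (Tset G Tv part j))
      ≡⟨ cong₂ _xor_ ∑-odd-edgesIn-parts ∑-odd-card-Tset ⟩
    ∑² samePartEdge xor (∑² earlierPartEdge xor ∑[ v < n ] Tv v)
      ≡⟨ xor-assoc (∑² samePartEdge) _ _ ⟨
    (∑² samePartEdge xor ∑² earlierPartEdge) xor ∑[ v < n ] Tv v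
      ≡⟨ cong (_xor ∑[ v < n ] Tv v) ∑-samePartEdge-xor-earlierPartEdge ⟩
    ∑² orderedEdge xor ∑[ v < n ] Tv v
      ≡⟨ cong₂ _xor_ (odd-edgesIn G (λ _ → true)) (odd-card Tv) ⟨
    odd (edgeCount G) xor odd (card Tv)
      ≡⟨ odd-+ (edgeCount G) (card Tv) ⟨
    odd (edgeCount G + card Tv) ∎
    where open ≡-Reasoning

lemma4 : ∀ {n k} (G : Graph n) (Tv : VSet n) (part : Decomp n k) (i : Fin (ℕ.suc k)) →
         Even (edgeCount G + card Tv) →
         (∀ j → j ≢ i → SatP G Tv part j) →
         ∀ j → SatP G Tv part j
lemma4 G Tv part i even-total sat j with j ≟ i
... | no j≢i   = sat j j≢i
... | yes refl = odd≡false⇒Even {size j} (begin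
  odd (size j)                  ≡⟨ sum-single-support xor-commutativeMonoid (odd ∘ size) j
                                     (λ j′ j′≢j → Even⇒odd≡false {size j′} (sat j′ j′≢j)) ⟨
  ∑[ j′ < _ ] odd (size j′)     ≡⟨ ∑-odd-SatP G Tv part ⟩
  odd (edgeCount G + card Tv)   ≡⟨ Even⇒odd≡false {edgeCount G + card Tv} even-total ⟩
  false                         ∎)
  where
  open ≡-Reasoning
  size : Fin _ → ℕ
  size j = edgesIn G (partSet part j) + card (Tset G Tv part j)
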